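{- Let $m\ge1$, let $G=(V,E)$ be a finite graph with edge-labeling $\alpha$ by ideals of $\mathbb{Z}/m\mathbb{Z}$, and let $\rho:\mathbb{Z}\to\mathbb{Z}/m\mathbb{Z}$ be the natural surjection. Then $\rho_*:\mathbb{Z}_{G,\rho^{ -1}(\alpha)}\to(\mathbb{Z}/m\mathbb{Z})_{G,\alpha}$ is surjective. In particular, if $\{b_1,\dots,b_n\}$ is a basis of the $\mathbb{Z}$-module of integer splines $\mathbb{Z}_{G,\rho^{ -1}(\alpha)}$, then $\{\rho_*b_1,\dots,\rho_*b_n\}$ spans the $\mathbb{Z}$-module of splines $(\mathbb{Z}/m\mathbb{Z})_{G,\alpha}$.
   Context: For a finite graph $G=(V,E)$, a commutative ring $R$ with identity and an edge-labeling $\alpha:E\to\{\text{ideals of }R\}$, a spline is $f\in R^{|V|}$ with $f_u-f_v\in\alpha(uv)$ for every edge $uv$; $R_{G,\alpha}$ is the set of splines. $\rho^{ -1}(\alpha)$ is the edge-labeling $e\mapsto\rho^{ -1}(\alpha(e))$ by ideals of $\mathbb{Z}$, and $\rho_*$ applies $\rho$ coordinatewise. -}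

module Defs where

open import Data.Nat.Base using (ℕ; NonZero)
open import Data.Integer.Base using (ℤ; +_; _%ℕ_) renaming (_+_ to _+ℤ_; _-_ to _-ℤ_; _*_ to _*ℤ_)
open import Data.Integer.DivMod using (n%ℕd<d)
open import Data.Fin.Base using (Fin; fromℕ<; toℕ)
open import Data.Product using (Σ; _×_)
open import Relation.Binary.PropositionalEquality using (_≡_)
open import Level using (Level; suc; _⊔_)

-- ℤ/mℤ, represented by canonical residues 0,…,m-1.
ZMod : (m : ℕ) → Set
ZMod m = Fin m

ρ : (m : ℕ) .{{_ : NonZero m}} → ℤ → ZMod m
ρ m i = fromℕ< (n%ℕd<d i m)

lift : {m : ℕ} → ZMod m → ℤ
lift a = + toℕ a

module _ (m : ℕ) .{{_ : NonZero m}} where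
  0ₘ : ZMod m
  0ₘ = ρ m (+ 0)

  _+ₘ_ : ZMod m → ZMod m → ZMod m
  a +ₘ b = ρ m (lift a +ℤ lift b)

  _-ₘ_ : ZMod m → ZMod m → ZMod m
  a -ₘ b = ρ m (lift a -ℤ lift b)

  _*ₘ_ : ZMod m → ZMod m → ZMod m
  a *ₘ b = ρ m (lift a *ℤ lift b)

  _·ₘ_ : ℤ → ZMod m → ZMod m
  c ·ₘ a = ρ m (c *ℤ lift a)

  record Ideal : Set₁ where
    field
      mem    : ZMod m → Set
      zero∈  : mem 0ₘ
      +-closed : ∀ {a b} → mem a → mem b → mem (a +ₘ b)
      *-closed : ∀ r {a} → mem a → mem (r *ₘ a)
  open Ideal public

  sumₘ : (n : ℕ) → (Fin n → ZMod m) → ZMod m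
  sumₘ ℕ.zero f = 0ₘ
  sumₘ (ℕ.suc n) f = f Fin.zero +ₘ sumₘ n (λ i → f (Fin.suc i))
    where import Data.Nat.Base as ℕ; import Data.Fin.Base as Fin

sumℤ : (n : ℕ) → (Fin n → ℤ) → ℤ
sumℤ ℕ.zero f = + 0
  where import Data.Nat.Base as ℕ
sumℤ (ℕ.suc n) f = f Fin.zero +ℤ sumℤ n (λ i → f (Fin.suc i))
  where import Data.Nat.Base as ℕ; import Data.Fin.Base as Fin

record Graph : Set where
  field
    nV nE : ℕ
    end₁ end₂ : Fin nE → Fin nV
open Graph public

module _ (G : Graph) where
  IsSplineₘ : (m : ℕ) .{{_ : NonZero m}} → (Fin (nE G) → Ideal m) → (Fin (nV G) → ZMod m) → Set
  IsSplineₘ m α f = ∀ e → Ideal.mem (α e) (_-ₘ_ m (f (end₁ G e)) (f (end₂ G e)))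

  -- ρ⁻¹(α): the edge-labeling by ideals of ℤ, membership x ∈ ρ⁻¹(α e) ⟺ ρ x ∈ α e
  preimageLabel : (m : ℕ) .{{_ : NonZero m}} → (Fin (nE G) → Ideal m) → Fin (nE G) → ℤ → Set
  preimageLabel m α e x = Ideal.mem (α e) (ρ m x)

  IsSplineℤ : (m : ℕ) .{{_ : NonZero m}} → (Fin (nE G) → Ideal m) → (Fin (nV G) → ℤ) → Set
  IsSplineℤ m α F = ∀ e → preimageLabel m α e (F (end₁ G e) -ℤ F (end₂ G e))

ρ* : (m : ℕ) .{{_ : NonZero m}} {k : ℕ} → (Fin k → ℤ) → Fin k → ZMod m
ρ* m F v = ρ m (F v)

module Submission where

-- The integer labelling ρ⁻¹(α) is defined by  x ∈ ρ⁻¹(α e) ⟺ ρ x ∈ α e,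
-- so the whole theorem rests on two properties of ρ : ℤ → ℤ/mℤ:
--   * ρ has a section, the canonical lift  a ↦ + toℕ a,  and since the ring
--     operations of ℤ/mℤ are computed on lifts, the lift of a ℤ/mℤ-spline is
--     an integer spline; hence ρ_* is surjective;
--   * ρ is a ℤ-linear map, so ρ_* sends ℤ-linear combinations of integer
--     splines to the same combinations of their reductions; hence any
--     spanning family of integer splines reduces to a spanning family.
-- ℤ-linearity is derived from one arithmetic fact: integers congruent mod m
-- have the same residue, which follows from uniqueness of residues in [0,m).
-- The file proves uniqueness of residues, then the properties of ρ, then the
-- two spline statements, from which the theorem is assembled.

open import Defs
open import Data.Nat.Base using (ℕ; NonZero)
open import Data.Integer.Base using (ℤ; +_; _*_)
open import Data.Fin.Base using (Fin)
open import Data.Product using (Σ; _×_)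
open import Relation.Binary.PropositionalEquality using (_≡_)

import Data.Nat.Base as ℕ
import Data.Nat.Properties as ℕ
open import Data.Nat.DivMod using (m<n⇒m%n≡m)
open import Data.Integer.Base using (-[1+_]; -_; _/ℕ_; _%ℕ_; _+_; _-_)
open import Data.Integer.Properties using (+-injective; pos-+; pos-*; +-identityʳ; *-zeroˡ)
open import Data.Integer.DivMod using (n%ℕd<d; a≡a%ℕn+[a/ℕn]*n)
open import Data.Integer.Tactic.RingSolver using (solve-∀)
open import Data.Fin.Base using (toℕ; fromℕ<)
import Data.Fin.Base as Fin
open import Data.Fin.Properties using (toℕ-fromℕ<; toℕ-injective; toℕ<n)
open import Data.Product using (_,_)
open import Data.Empty using (⊥; ⊥-elim)
open import Relation.Binary.PropositionalEquality using (refl; sym; trans; cong; cong₂; module ≡-Reasoning)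

open ≡-Reasoning

-- Adding a positive multiple of m to a natural number lands at or above m,
-- so it cannot equal a number below m.
positive-multiple-escapes : ∀ {a b m} k → a ℕ.< m → + a ≡ + b + + ℕ.suc k * + m → ⊥
positive-multiple-escapes {a} {b} {m} k a<m eq = ℕ.<⇒≱ a<m m≤a
  where
  a≡b+[1+k]m : a ≡ b ℕ.+ ℕ.suc k ℕ.* m
  a≡b+[1+k]m = +-injective (begin
    + a                                ≡⟨ eq ⟩
    + b + + ℕ.suc k * + m              ≡⟨ cong (_+_ (+ b)) (sym (pos-* (ℕ.suc k) m)) ⟩
    + b + + (ℕ.suc k ℕ.* m)            ≡⟨ sym (pos-+ b (ℕ.suc k ℕ.* m)) ⟩
    + (b ℕ.+ ℕ.suc k ℕ.* m)            ∎)

  m≤a : m ℕ.≤ a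
  m≤a = ℕ.≤-trans (ℕ.m≤m+n m (k ℕ.* m))
          (ℕ.≤-trans (ℕ.m≤n+m (ℕ.suc k ℕ.* m) b) (ℕ.≤-reflexive (sym a≡b+[1+k]m)))

residue-unique : ∀ {m r r'} → r ℕ.< m → r' ℕ.< m → ∀ d → + r ≡ + r' + d * + m → r ≡ r'
residue-unique {m} {r} {r'} _ _ (+ 0) eq = +-injective (begin
  + r                ≡⟨ eq ⟩
  + r' + + 0 * + m   ≡⟨ cong (_+_ (+ r')) (*-zeroˡ (+ m)) ⟩
  + r' + + 0         ≡⟨ +-identityʳ (+ r') ⟩
  + r'               ∎)
residue-unique r<m _ (+ ℕ.suc k) eq = ⊥-elim (positive-multiple-escapes k r<m eq)
residue-unique {m} {r} {r'} _ r'<m -[1+ k ] eq =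
  ⊥-elim (positive-multiple-escapes k r'<m (begin
    + r'                                     ≡⟨ cancel (+ r') -[1+ k ] (+ m) ⟩
    (+ r' + -[1+ k ] * + m) + + ℕ.suc k * + m ≡⟨ cong (_+ + ℕ.suc k * + m) (sym eq) ⟩
    + r + + ℕ.suc k * + m                    ∎))
  where
  cancel : ∀ x d M → x ≡ (x + d * M) + (- d) * M
  cancel = solve-∀

%ℕ-cong : ∀ (m : ℕ) .{{_ : NonZero m}} x y k → x ≡ y + k * + m → x %ℕ m ≡ y %ℕ m
%ℕ-cong m x y k eq = residue-unique (n%ℕd<d x m) (n%ℕd<d y m) (y /ℕ m + k - x /ℕ m) (begin
  + (x %ℕ m)                                  ≡⟨ add-sub (+ (x %ℕ m)) (x /ℕ m) (+ m) ⟩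
  (+ (x %ℕ m) + x /ℕ m * + m) - x /ℕ m * + m  ≡⟨ cong (_- x /ℕ m * + m) (sym (a≡a%ℕn+[a/ℕn]*n x m)) ⟩
  x - x /ℕ m * + m                            ≡⟨ cong (_- x /ℕ m * + m) eq ⟩
  (y + k * + m) - x /ℕ m * + m                ≡⟨ cong (λ z → (z + k * + m) - x /ℕ m * + m) (a≡a%ℕn+[a/ℕn]*n y m) ⟩
  ((+ (y %ℕ m) + y /ℕ m * + m) + k * + m) - x /ℕ m * + m
                                              ≡⟨ regroup (+ (y %ℕ m)) (y /ℕ m) k (x /ℕ m) (+ m) ⟩
  + (y %ℕ m) + (y /ℕ m + k - x /ℕ m) * + m    ∎)
  where
  add-sub : ∀ r q M → r ≡ (r + q * M) - q * M
  add-sub = solve-∀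
  regroup : ∀ r q k q' M → ((r + q * M) + k * M) - q' * M ≡ r + (q + k - q') * M
  regroup = solve-∀

module Reduction (m : ℕ) .{{_ : NonZero m}} where

  lift-ρ : ∀ x → x ≡ lift (ρ m x) + x /ℕ m * + m
  lift-ρ x = trans (a≡a%ℕn+[a/ℕn]*n x m)
    (cong (λ r → + r + x /ℕ m * + m) (sym (toℕ-fromℕ< (n%ℕd<d x m))))

  ρ-cong : ∀ x y k → x ≡ y + k * + m → ρ m x ≡ ρ m y
  ρ-cong x y k eq = toℕ-injective (begin
    toℕ (ρ m x)  ≡⟨ toℕ-fromℕ< (n%ℕd<d x m) ⟩
    x %ℕ m       ≡⟨ %ℕ-cong m x y k eq ⟩
    y %ℕ m       ≡⟨ sym (toℕ-fromℕ< (n%ℕd<d y m)) ⟩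
    toℕ (ρ m y)  ∎)

  ρ-lift : ∀ (a : ZMod m) → ρ m (lift a) ≡ a
  ρ-lift a = toℕ-injective (trans (toℕ-fromℕ< (n%ℕd<d (lift a) m)) (m<n⇒m%n≡m (toℕ<n a)))

  ρ-+ : ∀ x y → ρ m (x + y) ≡ _+ₘ_ m (ρ m x) (ρ m y)
  ρ-+ x y = ρ-cong (x + y) (lift (ρ m x) + lift (ρ m y)) (x /ℕ m + y /ℕ m) (begin
    x + y                                                       ≡⟨ cong₂ _+_ (lift-ρ x) (lift-ρ y) ⟩
    (lift (ρ m x) + x /ℕ m * + m) + (lift (ρ m y) + y /ℕ m * + m) ≡⟨ regroup (lift (ρ m x)) (x /ℕ m) (lift (ρ m y)) (y /ℕ m) (+ m) ⟩
    (lift (ρ m x) + lift (ρ m y)) + (x /ℕ m + y /ℕ m) * + m       ∎)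
    where
    regroup : ∀ a p b q M → (a + p * M) + (b + q * M) ≡ (a + b) + (p + q) * M
    regroup = solve-∀

  ρ-· : ∀ c y → ρ m (c * y) ≡ _·ₘ_ m c (ρ m y)
  ρ-· c y = ρ-cong (c * y) (c * lift (ρ m y)) (c * (y /ℕ m)) (begin
    c * y                                   ≡⟨ cong (c *_) (lift-ρ y) ⟩
    c * (lift (ρ m y) + y /ℕ m * + m)       ≡⟨ distrib c (lift (ρ m y)) (y /ℕ m) (+ m) ⟩
    c * lift (ρ m y) + (c * (y /ℕ m)) * + m ∎)
    where
    distrib : ∀ c a q M → c * (a + q * M) ≡ c * a + (c * q) * M
    distrib = solve-∀

  ρ-sum : ∀ n (g : Fin n → ℤ) (h : Fin n → ZMod m)
        → (∀ i → ρ m (g i) ≡ h i) → ρ m (sumℤ n g) ≡ sumₘ m n h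
  ρ-sum ℕ.zero g h g↦h = refl
  ρ-sum (ℕ.suc n) g h g↦h = trans (ρ-+ (g Fin.zero) (sumℤ n (λ i → g (Fin.suc i))))
    (cong₂ (_+ₘ_ m) (g↦h Fin.zero)
      (ρ-sum n (λ i → g (Fin.suc i)) (λ i → h (Fin.suc i)) (λ i → g↦h (Fin.suc i))))

  ρ*-combination : ∀ {k} n (c : Fin n → ℤ) (b : Fin n → Fin k → ℤ) (v : Fin k)
    → ρ m (sumℤ n (λ i → c i * b i v)) ≡ sumₘ m n (λ i → _·ₘ_ m (c i) (ρ* m (b i) v))
  ρ*-combination n c b v = ρ-sum n (λ i → c i * b i v) _ (λ i → ρ-· (c i) (b i v))

module Splines (m : ℕ) .{{_ : NonZero m}} (G : Graph) (α : Fin (nE G) → Ideal m) where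
  open Reduction m

  -- The edge conditions of ρ⁻¹(α) on a lift are, by definition of the
  -- operations of ℤ/mℤ, exactly the edge conditions of α.
  lift-spline : (f : Fin (nV G) → ZMod m) → IsSplineₘ G m α f
              → IsSplineℤ G m α (λ v → lift (f v))
  lift-spline f f-spline = f-spline

  ρ*-surjective : (f : Fin (nV G) → ZMod m) → IsSplineₘ G m α f
    → Σ (Fin (nV G) → ℤ) (λ F → IsSplineℤ G m α F × ((v : Fin (nV G)) → ρ* m F v ≡ f v))
  ρ*-surjective f f-spline = (λ v → lift (f v)) , lift-spline f f-spline , λ v → ρ-lift (f v)

  ρ*-spans : (n : ℕ) (b : Fin n → Fin (nV G) → ℤ)
    → ((F : Fin (nV G) → ℤ) → IsSplineℤ G m α F
        → Σ (Fin n → ℤ) (λ c → (v : Fin (nV G)) → F v ≡ sumℤ n (λ i → c i * b i v)))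
    → (f : Fin (nV G) → ZMod m) → IsSplineₘ G m α f
    → Σ (Fin n → ℤ) (λ c → (v : Fin (nV G)) → f v ≡ sumₘ m n (λ i → _·ₘ_ m (c i) (ρ* m (b i) v)))
  ρ*-spans n b b-spans f f-spline with b-spans (λ v → lift (f v)) (lift-spline f f-spline)
  ... | c , lift-f≡comb = c , λ v → begin
    f v                                  ≡⟨ sym (ρ-lift (f v)) ⟩
    ρ m (lift (f v))                     ≡⟨ cong (ρ m) (lift-f≡comb v) ⟩
    ρ m (sumℤ n (λ i → c i * b i v))     ≡⟨ ρ*-combination n c b v ⟩
    sumₘ m n (λ i → _·ₘ_ m (c i) (ρ* m (b i) v)) ∎

-- Theorem: ρ_* is surjective, and it maps a basis of the integer splines to a
-- spanning set of the splines over ℤ/mℤ (only the spanning property of the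
-- basis is needed).
mainTheorem6 : (m : ℕ) .{{_ : NonZero m}} (G : Graph) (α : Fin (nE G) → Ideal m)
    → ((f : Fin (nV G) → ZMod m) → IsSplineₘ G m α f
        → Σ (Fin (nV G) → ℤ) (λ F → IsSplineℤ G m α F × ((v : Fin (nV G)) → ρ* m F v ≡ f v)))
    × ((n : ℕ) (b : Fin n → Fin (nV G) → ℤ)
        → ((i : Fin n) → IsSplineℤ G m α (b i))
        → ((c : Fin n → ℤ) → ((v : Fin (nV G)) → sumℤ n (λ i → c i * b i v) ≡ + 0) → (i : Fin n) → c i ≡ + 0)
        → ((F : Fin (nV G) → ℤ) → IsSplineℤ G m α F
            → Σ (Fin n → ℤ) (λ c → (v : Fin (nV G)) → F v ≡ sumℤ n (λ i → c i * b i v)))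
        → (f : Fin (nV G) → ZMod m) → IsSplineₘ G m α f
        → Σ (Fin n → ℤ) (λ c → (v : Fin (nV G)) → f v ≡ sumₘ m n (λ i → _·ₘ_ m (c i) (ρ* m (b i) v))))
mainTheorem6 m G α =
  ρ*-surjective , λ n b _ _ b-spans → ρ*-spans n b b-spans
  where open Splines m G α
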